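{- Let $\lambda,\mu$ be $k$-bounded partitions such that $\mu/\lambda$ is a horizontal strip and $\mu^{\omega_k}/\lambda^{\omega_k}$ is a vertical strip. Then $\mathfrak{c}(\lambda)\subseteq\mathfrak{c}(\mu)$ and $\mathfrak{c}(\mu)/\mathfrak{c}(\lambda)$ is a horizontal strip.
   Context: Fix $k\ge1$. Partitions are Ferrers diagrams in French convention: cells $(i,j)$, $1\le j\le\lambda_i$, $i$ the row (row 1 at bottom), $j$ the column. For partitions $\lambda\subseteq\mu$, $\mu/\lambda$ is a horizontal strip if it has at most one cell in each column, and a vertical strip if it has at most one cell in each row. The hook length of a cell $(i,j)$ of $\gamma$ is the number of cells $(i,j')\in\gamma$ with $j'\ge j$ plus the number of cells $(i',j)\in\gamma$ with $i'>i$; a cell is $k$-bounded if its hook length is at most $k$. A $(k+1)$-core is a partition with no cell of hook length $k+1$; $\mathcal{C}_{k+1}$ is the set of $(k+1)$-cores, $\mathcal{P}_k$ the set of $k$-bounded partitions (largest part at most $k$). $\mathfrak{p}:\mathcal{C}_{k+1}\to\mathcal{P}_k$, $\mathfrak{p}(\gamma)_i=$ number of $k$-bounded cells in row $i$ of $\gamma$, is a bijection; $\mathfrak{c}$ is its inverse. The $k$-conjugate of $\lambda\in\mathcal{P}_k$ is $\lambda^{\omega_k}=\mathfrak{p}(\mathfrak{c}(\lambda)')$, where $'$ denotes conjugation (equivalently, the parts of $\lambda^{\omega_k}$ are the numbers of $k$-bounded cells in the columns of $\mathfrak{c}(\lambda)$). -}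

module Defs where

open import Data.Nat using (ℕ; zero; suc; _+_; _∸_; _≤_; _<_; _≥_; _≤?_)
open import Data.List using (List; []; _∷_; length; filter; applyUpTo)
open import Data.List.Relation.Unary.All using (All)
open import Data.List.Relation.Unary.Linked using (Linked)
open import Data.Product using (_×_)
open import Relation.Binary.PropositionalEquality using (_≡_; _≢_)

-- A partition is a weakly decreasing list of positive integers
-- (λ₁ ≥ λ₂ ≥ … > 0); row 1 is the first entry (bottom row, French).
IsPartition : List ℕ → Set
IsPartition γ = Linked _≥_ γ × All (λ x → 0 < x) γ

IsKBounded : ℕ → List ℕ → Set
IsKBounded k γ = IsPartition γ × All (λ x → x ≤ k) γ

-- part γ i = γ_i (1-indexed), 0 beyond the length (and for i = 0).
part : List ℕ → ℕ → ℕ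
part []       _             = 0
part (x ∷ xs) zero          = 0
part (x ∷ xs) (suc zero)    = x
part (x ∷ xs) (suc (suc i)) = part xs (suc i)

conjPart : List ℕ → ℕ → ℕ
conjPart γ j = length (filter (λ x → j ≤? x) γ)

conjugate : List ℕ → List ℕ
conjugate γ = applyUpTo (λ n → conjPart γ (suc n)) (part γ 1)

Cell : List ℕ → ℕ → ℕ → Set
Cell γ i j = 1 ≤ i × 1 ≤ j × j ≤ part γ i

-- hook length of cell (i,j) of γ:
--   #{(i,j') ∈ γ : j' ≥ j} + #{(i',j) ∈ γ : i' > i}
--   = (γ_i - j + 1) + (γ'_j - i)
hook : List ℕ → ℕ → ℕ → ℕ
hook γ i j = suc (part γ i ∸ j) + (conjPart γ j ∸ i)

IsCore : ℕ → List ℕ → Set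
IsCore k γ = IsPartition γ × (∀ i j → Cell γ i j → hook γ i j ≢ suc k)

boundedInRow : ℕ → List ℕ → ℕ → ℕ
boundedInRow k γ i =
  length (filter (λ j → hook γ i j ≤? k) (applyUpTo suc (part γ i)))

-- the map 𝔭 : 𝒞_{k+1} → 𝒫_k, given as its sequence of row values
-- (𝔭 γ)_i for i ≥ 1 (0 beyond the last row).
𝔭 : ℕ → List ℕ → ℕ → ℕ
𝔭 k γ i = boundedInRow k γ i

_≈rows_ : (ℕ → ℕ) → List ℕ → Set
f ≈rows lam = ∀ i → 1 ≤ i → f i ≡ part lam i

Contained : (ℕ → ℕ) → (ℕ → ℕ) → Set
Contained lam mu = ∀ i → 1 ≤ i → lam i ≤ mu i

InSkew : (ℕ → ℕ) → (ℕ → ℕ) → ℕ → ℕ → Set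
InSkew mu lam i j = 1 ≤ i × 1 ≤ j × j ≤ mu i × lam i < j

HorizontalStrip : (ℕ → ℕ) → (ℕ → ℕ) → Set
HorizontalStrip mu lam =
  Contained lam mu ×
  (∀ i i' j → InSkew mu lam i j → InSkew mu lam i' j → i ≡ i')

VerticalStrip : (ℕ → ℕ) → (ℕ → ℕ) → Set
VerticalStrip mu lam =
  Contained lam mu ×
  (∀ i j j' → InSkew mu lam i j → InSkew mu lam i j' → j ≡ j')

{-# OPTIONS --safe #-}
-- Along a row of a (k+1)-core γ the hook lengths (γᵢ - j + 1) + (γ'ⱼ - i) weakly
-- decrease, so the k-bounded cells are the last 𝔭(γ)ᵢ cells of the row, and as no hook
-- equals k+1, every other cell of the row has hook at least k+2.  Hence a row with at
-- most as many bounded cells as another, and legs at most as long in every column, is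
-- not longer: otherwise its cell in the column of the other row's first bounded cell
-- would be unbounded, which the hook formula forbids.  By downward induction on i (the
-- legs being controlled by the rows above) this turns λᵢ ≤ μᵢ into γᵢ ≤ δᵢ and
-- μᵢ₊₁ ≤ λᵢ into δᵢ₊₁ ≤ γᵢ, and these interlacing inequalities say that δ/γ is a
-- horizontal strip.
module Submission where

open import Defs
open import Data.Nat using (ℕ; zero; suc; _+_; _∸_; _≤_; _<_; _≥_; _≤?_; z≤n; s≤s)
open import Data.Nat.Properties
open import Data.List using (List; []; _∷_; length; filter; applyUpTo)
open import Data.List.Properties
  using (filter-accept; filter-reject; filter-all; filter-none; length-applyUpTo)
open import Data.List.Relation.Unary.All as All using (All; []; _∷_)
open import Data.List.Relation.Unary.All.Properties using (applyUpTo⁺₁)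
open import Data.List.Relation.Unary.Linked as Linked using (Linked)
open import Data.List.Relation.Unary.Linked.Properties using (Linked⇒All)
open import Data.Sum using (inj₁; inj₂)
open import Data.Product using (_×_; _,_; proj₁; proj₂; ∃-syntax)
open import Level using (Level)
open import Relation.Binary using (tri<; tri≈; tri>)
open import Relation.Binary.PropositionalEquality
  using (_≡_; _≢_; refl; sym; trans; cong; subst; subst₂)
open import Relation.Nullary using (¬_; Dec; yes; no; contradiction)
open import Relation.Unary using (Pred; Decidable)

private
  variable
    ℓ : Level
    k : ℕ

module _ {P : Pred ℕ ℓ} (P? : Decidable P) where

  Threshold : (ℕ → ℕ) → ℕ → Set ℓ
  Threshold f n = ∃[ s ] s ≤ n × (∀ x → x < s → ¬ P (f x)) × (∀ x → s ≤ x → x < n → P (f x)) ×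
                         length (filter P? (applyUpTo f n)) ≡ n ∸ s

  threshold-upClosed : ∀ f n → (∀ {x y} → x ≤ y → y < n → P (f x) → P (f y)) → Threshold f n
  threshold-upClosed f zero    up = 0 , z≤n , (λ _ ()) , (λ _ _ ()) , refl
  threshold-upClosed f (suc n) up = cases (P? (f 0))
    where
    cases : Dec (P (f 0)) → Threshold f (suc n)
    cases (yes P0) = 0 , z≤n , (λ _ ()) , (λ _ _ → all) , count
      where
      all : ∀ {x} → x < suc n → P (f x)
      all x<n = up z≤n x<n P0
      count : length (filter P? (applyUpTo f (suc n))) ≡ suc n
      count = trans (cong length (filter-all P? (applyUpTo⁺₁ f (suc n) all)))
                    (length-applyUpTo f (suc n))
    cases (no ¬P0) with threshold-upClosed (λ x → f (suc x)) n (λ x≤y y<n → up (s≤s x≤y) (s≤s y<n))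
    ... | s , s≤n , below , above , count =
      suc s , s≤s s≤n , below′ , above′ , trans (cong length (filter-reject P? ¬P0)) count
      where
      below′ : ∀ x → x < suc s → ¬ P (f x)
      below′ zero    _         = ¬P0
      below′ (suc x) (s≤s x<s) = below x x<s
      above′ : ∀ x → suc s ≤ x → x < suc n → P (f x)
      above′ (suc x) (s≤s s≤x) (s≤s x<n) = above x s≤x x<n

-- A row of g cells in which cell j has hook (g - j + 1) + leg j and the k-bounded
-- cells are the last l ones.
record RowSplit (k g l : ℕ) (leg : ℕ → ℕ) : Set where
  field
    unbounded           : ℕ
    unbounded+bounded   : unbounded + l ≡ g
    first-bounded-hook  : l + leg (suc unbounded) ≤ k
    unbounded-hook      : ∀ j → 1 ≤ j → j ≤ unbounded → k < l + leg j

open RowSplit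

rowSplit : ∀ k g (leg : ℕ → ℕ) →
  (∀ {a b} → a ≤ b → leg b ≤ leg a) → leg (suc g) ≡ 0 →
  (∀ j → 1 ≤ j → j ≤ g → suc (g ∸ j) + leg j ≢ suc k) →
  RowSplit k g (length (filter (λ j → suc (g ∸ j) + leg j ≤? k) (applyUpTo suc g))) leg
rowSplit k g leg leg-antitone leg-beyond no-hook[k+1] =
  split (threshold-upClosed (λ j → hookAt j ≤? k) suc g
           (λ x≤y _ → ≤-trans (hook-antitone (s≤s x≤y))))
  where
  hookAt : ℕ → ℕ
  hookAt j = suc (g ∸ j) + leg j

  hook-antitone : ∀ {a b} → a ≤ b → hookAt b ≤ hookAt a
  hook-antitone a≤b = +-mono-≤ (s≤s (∸-monoʳ-≤ g a≤b)) (leg-antitone a≤b)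

  first-bounded : ∀ t → t ≤ g → (∀ x → t ≤ x → x < g → hookAt (suc x) ≤ k) → g ∸ t + leg (suc t) ≤ k
  first-bounded t t≤g bounded-cells with m≤n⇒m<n∨m≡n t≤g
  ... | inj₁ t<g =
    subst (λ l → l + leg (suc t) ≤ k) (sym (+-∸-assoc 1 t<g)) (bounded-cells t ≤-refl t<g)
  ... | inj₂ refl rewrite n∸n≡0 t | leg-beyond = z≤n

  unbounded-leg : ∀ t → t ≤ g → (∀ x → x < t → ¬ hookAt (suc x) ≤ k) →
                  ∀ j → 1 ≤ j → j ≤ t → k < g ∸ t + leg j
  unbounded-leg (suc t) t<g unbounded-cells (suc j) _ j≤t =
    ≤-trans (≤-pred hook[t]>k+1) (+-monoʳ-≤ (g ∸ suc t) (leg-antitone j≤t))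
    where
    hook[t]>k+1 : suc k < hookAt (suc t)
    hook[t]>k+1 = ≤∧≢⇒< (≰⇒> (unbounded-cells t ≤-refl))
                        (λ eq → no-hook[k+1] (suc t) (s≤s z≤n) t<g (sym eq))

  split : Threshold (λ j → hookAt j ≤? k) suc g →
          RowSplit k g (length (filter (λ j → hookAt j ≤? k) (applyUpTo suc g))) leg
  split (s , s≤g , unbounded-cells , bounded-cells , count) = record
    { unbounded          = s
    ; unbounded+bounded  = trans (cong (s +_) count) (m+[n∸m]≡n s≤g)
    ; first-bounded-hook = subst (λ l → l + leg (suc s) ≤ k) (sym count)
                                 (first-bounded s s≤g bounded-cells)
    ; unbounded-hook     = λ j 1≤j j≤s →
        subst (λ l → k < l + leg j) (sym count) (unbounded-leg s s≤g unbounded-cells j 1≤j j≤s)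
    }

RowSplit-≤ : ∀ {g h l m} {legα legβ : ℕ → ℕ} → RowSplit k g l legα → RowSplit k h m legβ →
             l ≤ m → (∀ j → 1 ≤ j → legα j ≤ legβ j) → g ≤ h
RowSplit-≤ {k} {g} {h} {l} {m} {legα} {legβ} α β l≤m legα≤legβ with g ≤? h
... | yes g≤h = g≤h
... | no g≰h = contradiction hook-bounded (<⇒≱ (unbounded-hook α c (s≤s z≤n) c≤sα))
  where
  c : ℕ
  c = suc (unbounded β)
  c≤sα : c ≤ unbounded α
  c≤sα = +-cancelʳ-< m (unbounded β) (unbounded α) (begin-strict
    unbounded β + m ≡⟨ unbounded+bounded β ⟩
    h               <⟨ ≰⇒> g≰h ⟩
    g               ≡⟨ unbounded+bounded α ⟨
    unbounded α + l ≤⟨ +-monoʳ-≤ (unbounded α) l≤m ⟩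
    unbounded α + m ∎)
    where open ≤-Reasoning
  hook-bounded : l + legα c ≤ k
  hook-bounded = ≤-trans (+-mono-≤ l≤m (legα≤legβ c (s≤s z≤n))) (first-bounded-hook β)

tail-≤-head : ∀ {x xs} → Linked _≥_ (x ∷ xs) → All (_≤ x) xs
tail-≤-head l = All.tail (Linked⇒All (λ y≤x z≤y → ≤-trans z≤y y≤x) ≤-refl l)

part-≤-bound : ∀ {x xs} → All (_≤ x) xs → ∀ i → part xs i ≤ x
part-≤-bound []       _             = z≤n
part-≤-bound (_ ∷ _)  zero          = z≤n
part-≤-bound (p ∷ _)  (suc zero)    = p
part-≤-bound (_ ∷ ps) (suc (suc i)) = part-≤-bound ps (suc i)

part-antitone : ∀ {γ} → Linked _≥_ γ → ∀ {i i′} → 1 ≤ i → i ≤ i′ → part γ i′ ≤ part γ i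
part-antitone {[]}    _ _ _ = z≤n
part-antitone {_ ∷ _} l {suc zero}    {suc zero}     _ _ = ≤-refl
part-antitone {_ ∷ _} l {suc zero}    {suc (suc i′)} _ _ = part-≤-bound (tail-≤-head l) (suc i′)
part-antitone {_ ∷ _} l {suc (suc i)} {suc (suc i′)} _ (s≤s i≤i′) =
  part-antitone (Linked.tail l) (s≤s z≤n) i≤i′

part-beyond-length : ∀ γ i → length γ < i → part γ i ≡ 0
part-beyond-length []       _             _         = refl
part-beyond-length (_ ∷ _)  zero          _         = refl
part-beyond-length (_ ∷ xs) (suc (suc i)) (s≤s len<) = part-beyond-length xs (suc i) len<

conjPart-∷-≤ : ∀ {j x} xs → j ≤ x → conjPart (x ∷ xs) j ≡ suc (conjPart xs j)
conjPart-∷-≤ {j} xs j≤x = cong length (filter-accept (j ≤?_) {xs = xs} j≤x)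

conjPart-∷-≰ : ∀ {j x} xs → ¬ j ≤ x → conjPart (x ∷ xs) j ≡ conjPart xs j
conjPart-∷-≰ {j} xs j≰x = cong length (filter-reject (j ≤?_) {xs = xs} j≰x)

conjPart-antitone : ∀ γ {a b} → a ≤ b → conjPart γ b ≤ conjPart γ a
conjPart-antitone []       a≤b = z≤n
conjPart-antitone (x ∷ xs) {a} {b} a≤b with b ≤? x | a ≤? x
... | yes b≤x | yes a≤x rewrite conjPart-∷-≤ xs b≤x | conjPart-∷-≤ xs a≤x =
  s≤s (conjPart-antitone xs a≤b)
... | yes b≤x | no a≰x = contradiction (≤-trans a≤b b≤x) a≰x
... | no b≰x | yes a≤x rewrite conjPart-∷-≰ xs b≰x | conjPart-∷-≤ xs a≤x =
  m≤n⇒m≤1+n (conjPart-antitone xs a≤b)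
... | no b≰x | no a≰x rewrite conjPart-∷-≰ xs b≰x | conjPart-∷-≰ xs a≰x =
  conjPart-antitone xs a≤b

conjPart-beyond-bound : ∀ {x j xs} → All (_≤ x) xs → x < j → conjPart xs j ≡ 0
conjPart-beyond-bound {j = j} xs≤x x<j =
  cong length (filter-none (j ≤?_) (All.map (λ y≤x j≤y → <⇒≱ x<j (≤-trans j≤y y≤x)) xs≤x))

≤-part⇒≤-conjPart : ∀ {γ} → Linked _≥_ γ → ∀ {i j} → 1 ≤ i → 1 ≤ j → j ≤ part γ i → i ≤ conjPart γ j
≤-part⇒≤-conjPart {[]}     _ _ (s≤s _) ()
≤-part⇒≤-conjPart {x ∷ xs} l {suc zero} _ _ j≤x rewrite conjPart-∷-≤ xs j≤x = s≤s z≤n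
≤-part⇒≤-conjPart {x ∷ xs} l {suc (suc i)} _ 1≤j j≤part
  rewrite conjPart-∷-≤ xs (≤-trans j≤part (part-≤-bound (tail-≤-head l) (suc i))) =
  s≤s (≤-part⇒≤-conjPart (Linked.tail l) (s≤s z≤n) 1≤j j≤part)

≤-conjPart⇒≤-part : ∀ {γ} → Linked _≥_ γ → ∀ {i j} → 1 ≤ i → i ≤ conjPart γ j → j ≤ part γ i
≤-conjPart⇒≤-part {x ∷ xs} l {suc i} {j} _ i<conj with j ≤? x
... | no j≰x
  rewrite conjPart-∷-≰ xs j≰x | conjPart-beyond-bound (tail-≤-head l) (≰⇒> j≰x) with () ← i<conj
≤-conjPart⇒≤-part {x ∷ xs} l {suc zero} _ _ | yes j≤x = j≤x
≤-conjPart⇒≤-part {x ∷ xs} l {suc (suc i)} _ i<conj | yes j≤x rewrite conjPart-∷-≤ xs j≤x =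
  ≤-conjPart⇒≤-part (Linked.tail l) (s≤s z≤n) (≤-pred i<conj)

leg : List ℕ → ℕ → ℕ → ℕ
leg γ i j = conjPart γ j ∸ i

coreRowSplit : ∀ {k γ} → IsCore k γ → ∀ {i} → 1 ≤ i → RowSplit k (part γ i) (𝔭 k γ i) (leg γ i)
coreRowSplit {k} {γ} ((sorted , _) , no-hook[k+1]) {i} 1≤i =
  rowSplit k (part γ i) (leg γ i) (λ a≤b → ∸-monoˡ-≤ i (conjPart-antitone γ a≤b)) leg-beyond-row
    (λ j 1≤j j≤γᵢ → no-hook[k+1] i j (1≤i , 1≤j , j≤γᵢ))
  where
  leg-beyond-row : leg γ i (suc (part γ i)) ≡ 0
  leg-beyond-row = m≤n⇒m∸n≡0 (≮⇒≥ (λ i<conj → 1+n≰n (≤-conjPart⇒≤-part sorted 1≤i (<⇒≤ i<conj))))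

-- Used with d = 0 under γᵣ ≤ δᵣ and with d = 1 under δᵣ₊₁ ≤ γᵣ for the rows r above i.
leg-≤ : ∀ {α β} → Linked _≥_ α → Linked _≥_ β → ∀ d i →
        (∀ r → i < r → part α (d + r) ≤ part β r) → ∀ {j} → 1 ≤ j → leg α (d + i) j ≤ leg β i j
leg-≤ {α} {β} sortedα sortedβ d i α≤β {j} 1≤j with conjPart α j ≤? d + i
... | yes c≤d+i = subst (_≤ leg β i j) (sym (m≤n⇒m∸n≡0 c≤d+i)) z≤n
... | no c≰d+i = begin
  c ∸ (d + i)      ≡⟨ ∸-+-assoc c d i ⟨
  (c ∸ d) ∸ i      ≤⟨ ∸-monoˡ-≤ i c∸d≤β′ⱼ ⟩
  conjPart β j ∸ i ∎
  where
  open ≤-Reasoning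
  c : ℕ
  c = conjPart α j
  d+i<c : d + i < c
  d+i<c = ≰⇒> c≰d+i
  i<c∸d : i < c ∸ d
  i<c∸d = m+n≤o⇒m≤o∸n (suc i) (subst (_≤ c) (cong suc (+-comm d i)) d+i<c)
  j≤β[c∸d] : j ≤ part β (c ∸ d)
  j≤β[c∸d] = ≤-trans
    (subst (λ x → j ≤ part α x) (sym (m+[n∸m]≡n (≤-trans (m≤m+n d i) (<⇒≤ d+i<c))))
      (≤-conjPart⇒≤-part sortedα (m<n⇒0<n d+i<c) ≤-refl))
    (α≤β (c ∸ d) i<c∸d)
  c∸d≤β′ⱼ : c ∸ d ≤ conjPart β j
  c∸d≤β′ⱼ = ≤-part⇒≤-conjPart sortedβ (m<n⇒0<n i<c∸d) 1≤j j≤β[c∸d]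

Interlacing : (ℕ → ℕ) → (ℕ → ℕ) → ℕ → Set
Interlacing mu lam i = lam i ≤ mu i × mu (suc i) ≤ lam i

horizontalStrip⇒interlacing : ∀ {lam mu} → Linked _≥_ lam → Linked _≥_ mu →
  HorizontalStrip (part mu) (part lam) → ∀ i → 1 ≤ i → Interlacing (part mu) (part lam) i
horizontalStrip⇒interlacing {lam} {mu} sortedλ sortedμ (contained , one-per-column) i 1≤i =
  contained i 1≤i , ≮⇒≥ two-cells-in-column
  where
  two-cells-in-column : ¬ part lam i < part mu (suc i)
  two-cells-in-column λᵢ<μᵢ₊₁ =
    <-irrefl (one-per-column i (suc i) (suc (part lam i)) lower upper) (n<1+n i)
    where
    lower : InSkew (part mu) (part lam) i (suc (part lam i))
    lower = 1≤i , s≤s z≤n , ≤-trans λᵢ<μᵢ₊₁ (part-antitone sortedμ 1≤i (n≤1+n i)) , ≤-refl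
    upper : InSkew (part mu) (part lam) (suc i) (suc (part lam i))
    upper = s≤s z≤n , s≤s z≤n , λᵢ<μᵢ₊₁ , s≤s (part-antitone sortedλ 1≤i (n≤1+n i))

interlacing⇒horizontalStrip : ∀ {γ δ} → Linked _≥_ δ →
  (∀ i → 1 ≤ i → Interlacing (part δ) (part γ) i) → HorizontalStrip (part δ) (part γ)
interlacing⇒horizontalStrip {γ} {δ} sortedδ interlacing =
  (λ i 1≤i → proj₁ (interlacing i 1≤i)) , one-per-column
  where
  no-cell-above : ∀ {i i′ j} → i < i′ →
                  InSkew (part δ) (part γ) i j → ¬ InSkew (part δ) (part γ) i′ j
  no-cell-above i<i′ (1≤i , _ , _ , γᵢ<j) (_ , _ , j≤δᵢ′ , _) =
    <⇒≱ γᵢ<j (≤-trans j≤δᵢ′ (≤-trans (part-antitone sortedδ (s≤s z≤n) i<i′)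
                                      (proj₂ (interlacing _ 1≤i))))

  one-per-column : ∀ i i′ j → InSkew (part δ) (part γ) i j → InSkew (part δ) (part γ) i′ j → i ≡ i′
  one-per-column i i′ j cell cell′ with <-cmp i i′
  ... | tri< i<i′ _ _ = contradiction cell′ (no-cell-above i<i′ cell)
  ... | tri≈ _ i≡i′ _ = i≡i′
  ... | tri> _ _ i′<i = contradiction cell (no-cell-above i′<i cell′)

downward-induction : ∀ {p} (P : ℕ → Set p) n → (∀ i → n ≤ i → P i) →
                     (∀ i → (∀ r → i < r → P r) → P i) → ∀ i → P i
downward-induction P n base step i = go n i (m≤m+n n i)
  where
  go : ∀ fuel i → n ≤ fuel + i → P i
  go zero       i n≤i = base i n≤i
  go (suc fuel) i n≤  = step i (λ r i<r → go fuel r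
    (≤-trans n≤ (subst (_≤ fuel + r) (+-suc fuel i) (+-monoʳ-≤ fuel i<r))))

cores-interlace : ∀ {k lam mu γ δ} → IsCore k γ → IsCore k δ → 𝔭 k γ ≈rows lam → 𝔭 k δ ≈rows mu →
  (∀ i → 1 ≤ i → Interlacing (part mu) (part lam) i) → ∀ i → 1 ≤ i → Interlacing (part δ) (part γ) i
cores-interlace {k} {lam} {mu} {γ} {δ} γ-core δ-core 𝔭γ≈λ 𝔭δ≈μ λμ-interlace =
  downward-induction (λ i → 1 ≤ i → Interlacing (part δ) (part γ) i) (suc (length γ + length δ))
    beyond-rows step
  where
  sortedγ : Linked _≥_ γ
  sortedγ = proj₁ (proj₁ γ-core)
  sortedδ : Linked _≥_ δ
  sortedδ = proj₁ (proj₁ δ-core)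

  beyond-rows : ∀ i → suc (length γ + length δ) ≤ i → 1 ≤ i → Interlacing (part δ) (part γ) i
  beyond-rows i longer _
    rewrite part-beyond-length γ i (≤-trans (s≤s (m≤m+n _ _)) longer)
          | part-beyond-length δ (suc i) (m≤n⇒m≤1+n (≤-trans (s≤s (m≤n+m _ _)) longer)) = z≤n , z≤n

  step : ∀ i → (∀ r → i < r → 1 ≤ r → Interlacing (part δ) (part γ) r) → 1 ≤ i →
         Interlacing (part δ) (part γ) i
  step i above 1≤i =
    RowSplit-≤ (coreRowSplit γ-core 1≤i) (coreRowSplit δ-core 1≤i)
      (subst₂ _≤_ (sym (𝔭γ≈λ i 1≤i)) (sym (𝔭δ≈μ i 1≤i)) (proj₁ (λμ-interlace i 1≤i)))
      (λ j → leg-≤ sortedγ sortedδ 0 i (λ r i<r → proj₁ (above r i<r (m<n⇒0<n i<r)))) ,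
    RowSplit-≤ (coreRowSplit δ-core (s≤s z≤n)) (coreRowSplit γ-core 1≤i)
      (subst₂ _≤_ (sym (𝔭δ≈μ (suc i) (s≤s z≤n))) (sym (𝔭γ≈λ i 1≤i)) (proj₂ (λμ-interlace i 1≤i)))
      (λ j → leg-≤ sortedδ sortedγ 1 i (λ r i<r → proj₂ (above r i<r (m<n⇒0<n i<r))))

proposition54 :
    (k : ℕ) → 1 ≤ k →
    (lam mu : List ℕ) → IsKBounded k lam → IsKBounded k mu →
    (γ δ : List ℕ) → IsCore k γ → IsCore k δ →
    𝔭 k γ ≈rows lam → 𝔭 k δ ≈rows mu →
    HorizontalStrip (part mu) (part lam) →
    VerticalStrip (𝔭 k (conjugate δ)) (𝔭 k (conjugate γ)) →
    Contained (part γ) (part δ) × HorizontalStrip (part δ) (part γ)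
proposition54 k _ lam mu ((sortedλ , _) , _) ((sortedμ , _) , _) γ δ γ-core δ-core 𝔭γ≈λ 𝔭δ≈μ
              μ/λ-strip _ =
  proj₁ δ/γ-strip , δ/γ-strip
  where
  δ/γ-strip : HorizontalStrip (part δ) (part γ)
  δ/γ-strip = interlacing⇒horizontalStrip {γ} (proj₁ (proj₁ δ-core))
    (cores-interlace {lam = lam} {mu} γ-core δ-core 𝔭γ≈λ 𝔭δ≈μ
      (horizontalStrip⇒interlacing sortedλ sortedμ μ/λ-strip))
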